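{- An $r$-pattern $P$ is collectable if and only if it is splittable. Moreover, if $P$ is not splittable, then every $P$-clique has size at most two.
   Context: An ordered $r$-matching is a set of pairwise disjoint $r$-element subsets (edges) covering a finite linearly ordered set, considered up to order-isomorphism; it is represented by a word in which two positions carry the same letter iff they lie in the same edge. An $r$-pattern is an ordered $r$-matching with two edges, written as a word of length $2r$ in letters $A,B$, each occurring $r$ times. Two edges form pattern $P$ if, with the induced order, they are order-isomorphic to $P$. A $P$-clique is a matching in which every pair of edges forms $P$. $P$ is collectable if for every $k\ge2$ there is a $P$-clique of size $k$. $P$ is splittable if its word can be split into consecutive blocks, each consisting of an $A$-run $A^t$ and a $B$-run $B^t$ of the same length $t$ (in either order, i.e. $A^tB^t$ or $B^tA^t$); e.g. $AABBABBA=|AABB|AB|BA|$ is splittable while $AABABB$ is not. -}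

module Defs where

open import Data.Nat using (ℕ; _≤_)
open import Data.Bool using (Bool; true; false; if_then_else_)
open import Data.Fin using (Fin; _≟_)
open import Data.List using (List; []; _∷_; _++_; map; filter; length; replicate; concatMap)
open import Data.Product using (Σ; _×_; _,_; ∃-syntax)
open import Data.Sum using (_⊎_)
open import Relation.Nullary using (¬_; ⌊_⌋)
open import Relation.Nullary.Decidable using (_⊎-dec_)
open import Relation.Binary.PropositionalEquality using (_≡_)

data Letter : Set where
  A B : Letter

isA : Letter → Bool
isA A = true
isA B = false

swapL : Letter → Letter
swapL A = B
swapL B = A

countA : List Letter → ℕ
countA [] = 0
countA (x ∷ w) = if isA x then Data.Nat.suc (countA w) else countA w
  where import Data.Nat

IsPattern : ℕ → List Letter → Set
IsPattern r P = (length P ≡ r Data.Nat.+ r) × (countA P ≡ r)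
  where import Data.Nat

-- An ordered r-matching with k edges, represented by a word over the
-- edge labels Fin k: each label occurs exactly r times.
IsMatching : ℕ → (k : ℕ) → List (Fin k) → Set
IsMatching r k w = (i : Fin k) → length (filter (_≟ i) w) ≡ r

restrict : {k : ℕ} → List (Fin k) → Fin k → Fin k → List Letter
restrict w i j =
  map (λ x → if ⌊ x ≟ i ⌋ then A else B) (filter (λ x → (x ≟ i) ⊎-dec (x ≟ j)) w)

-- Edges i and j of w form pattern P (up to order-isomorphism, i.e. up to
-- the choice which of the two edges is called A).
FormsPattern : {k : ℕ} → List (Fin k) → Fin k → Fin k → List Letter → Set
FormsPattern w i j P = (restrict w i j ≡ P) ⊎ (map swapL (restrict w i j) ≡ P)

IsClique : ℕ → List Letter → (k : ℕ) → List (Fin k) → Set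
IsClique r P k w = IsMatching r k w × ((i j : Fin k) → ¬ (i ≡ j) → FormsPattern w i j P)

Collectable : ℕ → List Letter → Set
Collectable r P = (k : ℕ) → 2 ≤ k → ∃[ w ] IsClique r P k w

block : ℕ × Bool → List Letter
block (t , true)  = replicate t A ++ replicate t B
block (t , false) = replicate t B ++ replicate t A

Splittable : List Letter → Set
Splittable P = ∃[ bs ] (concatMap block bs ≡ P)

-- Let three edges a, b, c of a matching pairwise form P, and orient each pair by the edge playing A.
-- A cyclic orientation forces P = [], since the first of a, b, c in the word would have to be both
-- the A of one pair and the B of another. For a transitive orientation a → b → c with P = A^s B ⋯,
-- read the word only at a, b, c. Before the first c there are exactly s a's (ac-pattern) and s b's
-- (bc-pattern), the a's first (ab-pattern), so P = A^s B^s ⋯; then the ac- and bc-patterns continue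
-- with B^s, so the word begins a^s b^s c^s, and what follows forms the rest of P on all three pairs.
-- Exchanging a and c treats P = B ⋯.
-- Conversely, a splitting of P gives cliques of every size k: write each block A^t B^t as
-- 0^t 1^t ⋯ (k-1)^t and each B^t A^t as its mirror image. The matching condition is automatic, as
-- every edge is one side of an r-pattern.

{-# OPTIONS --safe #-}
module Submission where

open import Data.Bool using (Bool; true; false; not; if_then_else_)
open import Data.Empty using (⊥-elim)
open import Data.Fin using (Fin; zero; suc; _≟_; _<_)
open import Data.Fin.Properties using (<-cmp)
open import Data.List using (List; []; _∷_; _++_; map; mapMaybe; filter; length; replicate; concatMap)
open import Data.List.Properties
  using (∷-injectiveˡ; ∷-injectiveʳ; ++-assoc; ++-identityʳ; ++-cancelˡ; length-map; length-++-≤ʳ;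
         map-++; map-∘; map-id; map-cong; map-replicate; concatMap-map; map-concatMap; concatMap-cong;
         mapMaybe-++; mapMaybe-map; map-mapMaybe; mapMaybe-cong; mapMaybe-nothing)
open import Data.Maybe using (Maybe; just; nothing; _<∣>_)
import Data.Maybe as Maybe
open import Data.Nat using (ℕ; zero; suc; _+_; _≤_; z≤n; s≤s; s≤s⁻¹)
open import Data.Nat.Properties using (≤-refl; ≤-trans; n≤1+n; +-suc; +-cancelʳ-≡)
open import Data.Product using (_×_; _,_; ∃-syntax)
open import Data.Sum using (_⊎_; inj₁; inj₂)
open import Function.Base using (_∘_)
open import Function.Bundles using (_⇔_; mk⇔)
open import Relation.Binary.Definitions using (tri<; tri≈; tri>)
open import Relation.Binary.PropositionalEquality
open import Relation.Nullary using (¬_; Dec; yes; no; does; ⌊_⌋)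
open import Relation.Nullary.Decidable using (_⊎-dec_)
open import Defs
open ≡-Reasoning

private
  variable
    k m n r : ℕ
    P : List Letter

mapMaybe-∷-just : ∀ {X Y : Set} (f : X → Maybe Y) {x y} xs → f x ≡ just y →
  mapMaybe f (x ∷ xs) ≡ y ∷ mapMaybe f xs
mapMaybe-∷-just f xs fx rewrite fx = refl

mapMaybe-∷-nothing : ∀ {X Y : Set} (f : X → Maybe Y) {x} xs → f x ≡ nothing →
  mapMaybe f (x ∷ xs) ≡ mapMaybe f xs
mapMaybe-∷-nothing f xs fx rewrite fx = refl

mapMaybe-split : ∀ {X Y : Set} (f : X → Maybe Y) xs us y vs → mapMaybe f xs ≡ us ++ y ∷ vs →
  ∃[ ys ] ∃[ x ] ∃[ zs ] xs ≡ ys ++ x ∷ zs × mapMaybe f ys ≡ us × f x ≡ just y × mapMaybe f zs ≡ vs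
mapMaybe-split f [] []       y vs ()
mapMaybe-split f [] (_ ∷ _) y vs ()
mapMaybe-split f (x ∷ xs) us y vs eq with f x in fx
mapMaybe-split f (x ∷ xs) []       y vs eq | just z =
  [] , x , xs , refl , refl , trans fx (cong just (∷-injectiveˡ eq)) , ∷-injectiveʳ eq
mapMaybe-split f (x ∷ xs) (u ∷ us) y vs eq | just z
  with ys , x′ , zs , refl , pys , px′ , pzs ← mapMaybe-split f xs us y vs (∷-injectiveʳ eq) =
  x ∷ ys , x′ , zs , refl , trans (mapMaybe-∷-just f ys fx) (cong₂ _∷_ (∷-injectiveˡ eq) pys) , px′ , pzs
mapMaybe-split f (x ∷ xs) us y vs eq | nothing
  with ys , x′ , zs , refl , pys , px′ , pzs ← mapMaybe-split f xs us y vs eq =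
  x ∷ ys , x′ , zs , refl , trans (mapMaybe-∷-nothing f ys fx) pys , px′ , pzs

mapMaybe-replicate : ∀ {X Y : Set} (f : X → Maybe Y) t x →
  mapMaybe f (replicate t x) ≡ Maybe.maybe (replicate t) [] (f x)
mapMaybe-replicate f zero    x with f x
... | just _  = refl
... | nothing = refl
mapMaybe-replicate f (suc t) x with f x | mapMaybe-replicate f t x
... | just y  | ih = cong (y ∷_) ih
... | nothing | ih = ih

map-filter≡mapMaybe : ∀ {X Y : Set} {p} {Q : X → Set p} (Q? : ∀ x → Dec (Q x)) (f : X → Y) xs →
  map f (filter Q? xs) ≡ mapMaybe (λ x → if does (Q? x) then just (f x) else nothing) xs
map-filter≡mapMaybe Q? f []       = refl
map-filter≡mapMaybe Q? f (x ∷ xs) with does (Q? x)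
... | true  = cong (f x ∷_) (map-filter≡mapMaybe Q? f xs)
... | false = map-filter≡mapMaybe Q? f xs

replicate-++-∷-injective : ∀ {X : Set} {x y : X} {xs ys} → ¬ x ≡ y →
  replicate m x ++ y ∷ xs ≡ replicate n x ++ y ∷ ys → m ≡ n × xs ≡ ys
replicate-++-∷-injective {m = zero}  {n = zero}  x≢y eq = refl , ∷-injectiveʳ eq
replicate-++-∷-injective {m = zero}  {n = suc n} x≢y eq = ⊥-elim (x≢y (sym (∷-injectiveˡ eq)))
replicate-++-∷-injective {m = suc m} {n = zero}  x≢y eq = ⊥-elim (x≢y (∷-injectiveˡ eq))
replicate-++-∷-injective {m = suc m} {n = suc n} x≢y eq
  with refl , xs≡ys ← replicate-++-∷-injective {m = m} {n = n} x≢y (∷-injectiveʳ eq) = refl , xs≡ys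

length-≤-++-∷-++ : ∀ {X : Set} (xs : List X) y zs ys → length ys ≤ length (xs ++ y ∷ zs ++ ys)
length-≤-++-∷-++ xs y zs ys =
  ≤-trans (length-++-≤ʳ ys {zs}) (≤-trans (n≤1+n _) (length-++-≤ʳ (y ∷ zs ++ ys) {xs}))

A≢B : ¬ A ≡ B
A≢B ()

B≢A : ¬ B ≡ A
B≢A ()

Bᵐ≢A∷ : ∀ m {xs} → ¬ replicate m B ≡ A ∷ xs
Bᵐ≢A∷ zero    ()
Bᵐ≢A∷ (suc m) ()

swapL-involutive : ∀ x → swapL (swapL x) ≡ x
swapL-involutive A = refl
swapL-involutive B = refl

map-swapL-involutive : ∀ P → map swapL (map swapL P) ≡ P
map-swapL-involutive P = trans (sym (map-∘ P)) (trans (map-cong swapL-involutive P) (map-id P))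

countA-swap : ∀ P → countA (map swapL P) + countA P ≡ length P
countA-swap []      = refl
countA-swap (A ∷ P) = trans (+-suc (countA (map swapL P)) (countA P)) (cong suc (countA-swap P))
countA-swap (B ∷ P) = cong suc (countA-swap P)

leading-A-run : ∀ P → (∃[ t ] ∃[ R ] P ≡ replicate t A ++ B ∷ R) ⊎ (∃[ t ] P ≡ replicate t A)
leading-A-run []      = inj₂ (0 , refl)
leading-A-run (B ∷ P) = inj₁ (0 , P , refl)
leading-A-run (A ∷ P) with leading-A-run P
... | inj₁ (t , R , refl) = inj₁ (suc t , R , refl)
... | inj₂ (t , refl)     = inj₂ (suc t , refl)

flipBlock : ℕ × Bool → ℕ × Bool
flipBlock (t , f) = t , not f

block-flipBlock : ∀ p → block (flipBlock p) ≡ map swapL (block p)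
block-flipBlock (t , true)  = sym (trans (map-++ swapL (replicate t A) _)
                                         (cong₂ _++_ (map-replicate swapL t A) (map-replicate swapL t B)))
block-flipBlock (t , false) = sym (trans (map-++ swapL (replicate t B) _)
                                         (cong₂ _++_ (map-replicate swapL t B) (map-replicate swapL t A)))

splittable-swap : Splittable P → Splittable (map swapL P)
splittable-swap (bs , refl) = map flipBlock bs , (begin
  concatMap block (map flipBlock bs)     ≡⟨ concatMap-map block flipBlock bs ⟩
  concatMap (block ∘ flipBlock) bs       ≡⟨ concatMap-cong block-flipBlock bs ⟩
  concatMap (map swapL ∘ block) bs       ≡⟨ map-concatMap swapL block bs ⟨
  map swapL (concatMap block bs)         ∎)

splittable-unswap : Splittable (map swapL P) → Splittable P
splittable-unswap {P} = subst Splittable (map-swapL-involutive P) ∘ splittable-swap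

-- a, b, c are three edges of a matching and o stands for all the others; πxy is the pattern
-- formed by edges x and y with x written A.
data Tri : Set where
  a b c o : Tri

ab bc ac : Tri → Maybe Letter
ab a = just A
ab b = just B
ab _ = nothing
bc b = just A
bc c = just B
bc _ = nothing
ac a = just A
ac c = just B
ac _ = nothing

πab πbc πac : List Tri → List Letter
πab = mapMaybe ab
πbc = mapMaybe bc
πac = mapMaybe ac

FormsOnAllPairs : List Tri → List Letter → Set
FormsOnAllPairs W P = πab W ≡ P × πbc W ≡ P × πac W ≡ P

no-b⇒πbc-only-B : ∀ W → πab W ≡ replicate n A → ∃[ m ] πbc W ≡ replicate m B
no-b⇒πbc-only-B []      _ = 0 , refl
no-b⇒πbc-only-B {suc n} (a ∷ W) eq = no-b⇒πbc-only-B W (∷-injectiveʳ eq)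
no-b⇒πbc-only-B {suc n} (b ∷ W) eq = ⊥-elim (B≢A (∷-injectiveˡ eq))
no-b⇒πbc-only-B (c ∷ W) eq with m , eq′ ← no-b⇒πbc-only-B W eq = suc m , cong (B ∷_) eq′
no-b⇒πbc-only-B (o ∷ W) eq = no-b⇒πbc-only-B W eq

no-bc⇒πac≡πab : ∀ W → πbc W ≡ [] → πac W ≡ πab W
no-bc⇒πac≡πab []      _  = refl
no-bc⇒πac≡πab (a ∷ W) eq = cong (A ∷_) (no-bc⇒πac≡πab W eq)
no-bc⇒πac≡πab (o ∷ W) eq = no-bc⇒πac≡πab W eq

no-ac⇒only-b : ∀ W → πac W ≡ [] → ∃[ m ] πbc W ≡ replicate m A × πab W ≡ replicate m B
no-ac⇒only-b []      _ = 0 , refl , refl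
no-ac⇒only-b (b ∷ W) eq with m , p , q ← no-ac⇒only-b W eq = suc m , cong (A ∷_) p , cong (B ∷_) q
no-ac⇒only-b (o ∷ W) eq = no-ac⇒only-b W eq

ab⁻¹-B : ∀ l → ab l ≡ just B → l ≡ b
ab⁻¹-B b refl = refl

ac⁻¹-B : ∀ l → ac l ≡ just B → l ≡ c
ac⁻¹-B c refl = refl

split-at-first-b : ∀ s W R Q → πab W ≡ replicate s A ++ B ∷ R → πbc W ≡ A ∷ Q →
  ∃[ V ] πab V ≡ R × πbc V ≡ Q × πac W ≡ replicate s A ++ πac V
split-at-first-b s W R Q p q
  with U , l , V , refl , pU , pl , pV ← mapMaybe-split ab W (replicate s A) B R p
  with refl ← ab⁻¹-B l pl
  with m , qU ← no-b⇒πbc-only-B U pU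
  with refl , qV ← replicate-++-∷-injective {m = m} {n = 0} B≢A (begin
         replicate m B ++ A ∷ πbc V  ≡⟨ cong (_++ A ∷ πbc V) qU ⟨
         πbc U ++ πbc (b ∷ V)       ≡⟨ mapMaybe-++ bc U (b ∷ V) ⟨
         πbc W                      ≡⟨ q ⟩
         A ∷ Q                      ∎)
  = V , pV , qV , (begin
         πac W                      ≡⟨ mapMaybe-++ ac U (b ∷ V) ⟩
         πac U ++ πac V             ≡⟨ cong (_++ πac V) (trans (no-bc⇒πac≡πab U qU) pU) ⟩
         replicate s A ++ πac V     ∎)

split-at-first-c : ∀ m W R Q → πac W ≡ B ∷ R → πbc W ≡ replicate m A ++ B ∷ Q →
  ∃[ V ] πac V ≡ R × πbc V ≡ Q × πab W ≡ replicate m B ++ πab V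
split-at-first-c m W R Q r q
  with U , l , V , refl , rU , rl , rV ← mapMaybe-split ac W [] B R r
  with refl ← ac⁻¹-B l rl
  with m′ , qU , pU ← no-ac⇒only-b U rU
  with refl , qV ← replicate-++-∷-injective {m = m′} {n = m} A≢B (begin
         replicate m′ A ++ B ∷ πbc V ≡⟨ cong (_++ B ∷ πbc V) qU ⟨
         πbc U ++ πbc (c ∷ V)       ≡⟨ mapMaybe-++ bc U (c ∷ V) ⟨
         πbc W                      ≡⟨ q ⟩
         replicate m A ++ B ∷ Q     ∎)
  = V , rV , qV , trans (mapMaybe-++ ab U (c ∷ V)) (cong (_++ πab V) pU)

drop-c-run : ∀ n W R → πab W ≡ R → πbc W ≡ replicate n B ++ R → πac W ≡ replicate n B ++ R →
  ∃[ V ] FormsOnAllPairs V R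
drop-c-run zero    W R p q r = W , p , q , r
drop-c-run (suc n) W R p q r
  with V , rV , qV , pW ← split-at-first-c 0 W (replicate n B ++ R) (replicate n B ++ R) r q
  = drop-c-run n V R (trans (sym pW) p) qV rV

peel-block : ∀ t R W → FormsOnAllPairs W (replicate (suc t) A ++ B ∷ R) →
  ∃[ R′ ] R ≡ replicate t B ++ R′ × ∃[ V ] FormsOnAllPairs V R′
peel-block t R W (p , q , r)
  with V , pV , qV , rW ← split-at-first-b (suc t) W R (replicate t A ++ B ∷ R) p q
  with V′ , rV′ , qV′ , pV′ ←
         split-at-first-c t V R R (++-cancelˡ (replicate (suc t) A) _ _ (trans (sym rW) r)) qV
  = πab V′ , R≡ , drop-c-run t V′ (πab V′) refl (trans qV′ R≡) (trans rV′ R≡)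
  where
  R≡ : R ≡ replicate t B ++ πab V′
  R≡ = trans (sym pV) pV′

only-A-impossible : ∀ t W → ¬ FormsOnAllPairs W (replicate (suc t) A)
only-A-impossible t W (p , q , _) with m , q′ ← no-b⇒πbc-only-B W p = Bᵐ≢A∷ m (trans (sym q′) q)

reflect : Tri → Tri
reflect a = c
reflect b = b
reflect c = a
reflect o = o

mapMaybe-reflect : ∀ (f g : Tri → Maybe Letter) → (∀ l → f (reflect l) ≡ Maybe.map swapL (g l)) →
  ∀ W → mapMaybe f (map reflect W) ≡ map swapL (mapMaybe g W)
mapMaybe-reflect f g f∘reflect W =
  trans (mapMaybe-map f reflect W) (trans (mapMaybe-cong f∘reflect W) (sym (map-mapMaybe swapL g W)))

forms-reflect : ∀ W → FormsOnAllPairs W P → FormsOnAllPairs (map reflect W) (map swapL P)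
forms-reflect W (p , q , r) =
  trans (mapMaybe-reflect ab bc (λ { a → refl ; b → refl ; c → refl ; o → refl }) W)
        (cong (map swapL) q) ,
  trans (mapMaybe-reflect bc ab (λ { a → refl ; b → refl ; c → refl ; o → refl }) W)
        (cong (map swapL) p) ,
  trans (mapMaybe-reflect ac ac (λ { a → refl ; b → refl ; c → refl ; o → refl }) W)
        (cong (map swapL) r)

splittable-by-fuel : ∀ n P W → length P ≤ n → FormsOnAllPairs W P → Splittable P
splittable-by-fuel-A : ∀ n P W → length P ≤ n → FormsOnAllPairs W (A ∷ P) → Splittable (A ∷ P)

splittable-by-fuel _       []      _ _   _ = [] , refl
splittable-by-fuel (suc n) (A ∷ P) W len f = splittable-by-fuel-A n P W (s≤s⁻¹ len) f
splittable-by-fuel (suc n) (B ∷ P) W len f =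
  splittable-unswap (splittable-by-fuel-A n (map swapL P) (map reflect W)
    (subst (_≤ n) (sym (length-map swapL P)) (s≤s⁻¹ len)) (forms-reflect W f))

splittable-by-fuel-A n P W len f with leading-A-run P
... | inj₂ (t , refl) = ⊥-elim (only-A-impossible t W f)
... | inj₁ (t , R , refl)
  with R′ , refl , V , f′ ← peel-block t R W f
  with bs , refl ←
         splittable-by-fuel n R′ V (≤-trans (length-≤-++-∷-++ (replicate t A) B (replicate t B) R′) len) f′
  = (suc t , true) ∷ bs , cong (A ∷_) (++-assoc (replicate t A) (B ∷ replicate t B) (concatMap block bs))

forms⇒splittable : ∀ W → FormsOnAllPairs W P → Splittable P
forms⇒splittable {P} W = splittable-by-fuel (length P) P W ≤-refl

cyclic⇒empty : ∀ W → πab W ≡ P → πbc W ≡ P → map swapL (πac W) ≡ P → P ≡ []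
cyclic⇒empty []      p q r = sym p
cyclic⇒empty (a ∷ W) p q r = ⊥-elim (A≢B (∷-injectiveˡ (trans p (sym r))))
cyclic⇒empty (b ∷ W) p q r = ⊥-elim (B≢A (∷-injectiveˡ (trans p (sym q))))
cyclic⇒empty (c ∷ W) p q r = ⊥-elim (B≢A (∷-injectiveˡ (trans q (sym r))))
cyclic⇒empty (o ∷ W) p q r = cyclic⇒empty W p q r

mark : Letter → Fin k → Fin k → Maybe Letter
mark ℓ x e = if does (e ≟ x) then just ℓ else nothing

label : Fin k → Fin k → Fin k → Maybe Letter
label x y e = mark A x e <∣> mark B y e

project : Fin k → Fin k → List (Fin k) → List Letter
project x y = mapMaybe (label x y)

restrict≡project : ∀ (w : List (Fin k)) x y → restrict w x y ≡ project x y w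
restrict≡project w x y = trans (map-filter≡mapMaybe _ _ w) (mapMaybe-cong pointwise w)
  where
  pointwise : ∀ e →
    (if does ((e ≟ x) ⊎-dec (e ≟ y)) then just (if ⌊ e ≟ x ⌋ then A else B) else nothing) ≡ label x y e
  pointwise e with e ≟ x | e ≟ y
  ... | yes _ | _     = refl
  ... | no _  | yes _ = refl
  ... | no _  | no _  = refl

project-swap : ∀ (w : List (Fin k)) {x y} → ¬ x ≡ y → project y x w ≡ map swapL (project x y w)
project-swap w {x} {y} x≢y = trans (mapMaybe-cong pointwise w) (sym (map-mapMaybe swapL (label x y) w))
  where
  pointwise : ∀ e → label y x e ≡ Maybe.map swapL (label x y e)
  pointwise e with e ≟ x | e ≟ y
  ... | yes refl | yes refl = ⊥-elim (x≢y refl)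
  ... | yes _    | no _     = refl
  ... | no _     | yes _    = refl
  ... | no _     | no _     = refl

Oriented : List (Fin k) → List Letter → Fin k → Fin k → Set
Oriented w P x y = project x y w ≡ P ⊎ project y x w ≡ P

forms⇒oriented : ∀ (w : List (Fin k)) {x y} → ¬ x ≡ y → FormsPattern w x y P → Oriented w P x y
forms⇒oriented w {x} {y} x≢y (inj₁ eq) = inj₁ (trans (sym (restrict≡project w x y)) eq)
forms⇒oriented {P = P} w {x} {y} x≢y (inj₂ eq) = inj₂ (begin
  project y x w                      ≡⟨ project-swap w x≢y ⟩
  map swapL (project x y w)          ≡⟨ cong (map swapL) (restrict≡project w x y) ⟨
  map swapL (restrict w x y)         ≡⟨ eq ⟩
  P                                  ∎)

classify : Fin k → Fin k → Fin k → Fin k → Tri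
classify x y z e = if does (e ≟ x) then a else if does (e ≟ y) then b else if does (e ≟ z) then c else o

πab-classify : ∀ (w : List (Fin k)) x y z → πab (map (classify x y z) w) ≡ project x y w
πab-classify w x y z = trans (mapMaybe-map ab (classify x y z) w) (mapMaybe-cong pointwise w)
  where
  pointwise : ∀ e → ab (classify x y z e) ≡ label x y e
  pointwise e with e ≟ x | e ≟ y | e ≟ z
  ... | yes _ | _     | _     = refl
  ... | no _  | yes _ | _     = refl
  ... | no _  | no _  | yes _ = refl
  ... | no _  | no _  | no _  = refl

πbc-classify : ∀ (w : List (Fin k)) {x y z} → ¬ x ≡ y → ¬ x ≡ z →
  πbc (map (classify x y z) w) ≡ project y z w
πbc-classify w {x} {y} {z} x≢y x≢z = trans (mapMaybe-map bc (classify x y z) w) (mapMaybe-cong pointwise w)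
  where
  pointwise : ∀ e → bc (classify x y z e) ≡ label y z e
  pointwise e with e ≟ x | e ≟ y | e ≟ z
  ... | yes refl | yes refl | _        = ⊥-elim (x≢y refl)
  ... | yes refl | no _     | yes refl = ⊥-elim (x≢z refl)
  ... | yes _    | no _     | no _     = refl
  ... | no _     | yes _    | _        = refl
  ... | no _     | no _     | yes _    = refl
  ... | no _     | no _     | no _     = refl

πac-classify : ∀ (w : List (Fin k)) {x y z} → ¬ y ≡ z →
  πac (map (classify x y z) w) ≡ project x z w
πac-classify w {x} {y} {z} y≢z = trans (mapMaybe-map ac (classify x y z) w) (mapMaybe-cong pointwise w)
  where
  pointwise : ∀ e → ac (classify x y z e) ≡ label x z e
  pointwise e with e ≟ x | e ≟ y | e ≟ z
  ... | yes _ | _        | _        = refl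
  ... | no _  | yes refl | yes refl = ⊥-elim (y≢z refl)
  ... | no _  | yes _    | no _     = refl
  ... | no _  | no _     | yes _    = refl
  ... | no _  | no _     | no _     = refl

transitive⇒splittable : ∀ (w : List (Fin k)) {x y z} → ¬ x ≡ y → ¬ x ≡ z → ¬ y ≡ z →
  project x y w ≡ P → project y z w ≡ P → project x z w ≡ P → Splittable P
transitive⇒splittable w x≢y x≢z y≢z pxy pyz pxz =
  forms⇒splittable (map (classify _ _ _) w)
    (trans (πab-classify w _ _ _) pxy ,
     trans (πbc-classify w x≢y x≢z) pyz ,
     trans (πac-classify w y≢z) pxz)

cyclic⇒splittable : ∀ (w : List (Fin k)) {x y z} → ¬ x ≡ y → ¬ x ≡ z → ¬ y ≡ z →
  project x y w ≡ P → project y z w ≡ P → project z x w ≡ P → Splittable P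
cyclic⇒splittable w x≢y x≢z y≢z pxy pyz pzx
  with refl ← cyclic⇒empty (map (classify _ _ _) w)
                (trans (πab-classify w _ _ _) pxy) (trans (πbc-classify w x≢y x≢z) pyz)
                (trans (cong (map swapL) (πac-classify w y≢z)) (trans (sym (project-swap w x≢z)) pzx))
  = [] , refl

three-edges⇒splittable : ∀ (w : List (Fin (3 + k))) →
  Oriented w P zero (suc zero) → Oriented w P (suc zero) (suc (suc zero)) →
  Oriented w P zero (suc (suc zero)) → Splittable P
three-edges⇒splittable w (inj₁ p₀₁) (inj₁ p₁₂) (inj₁ p₀₂) =
  transitive⇒splittable w (λ ()) (λ ()) (λ ()) p₀₁ p₁₂ p₀₂
three-edges⇒splittable w (inj₁ p₀₁) (inj₁ p₁₂) (inj₂ p₂₀) =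
  cyclic⇒splittable w (λ ()) (λ ()) (λ ()) p₀₁ p₁₂ p₂₀
three-edges⇒splittable w (inj₁ p₀₁) (inj₂ p₂₁) (inj₁ p₀₂) =
  transitive⇒splittable w (λ ()) (λ ()) (λ ()) p₀₂ p₂₁ p₀₁
three-edges⇒splittable w (inj₁ p₀₁) (inj₂ p₂₁) (inj₂ p₂₀) =
  transitive⇒splittable w (λ ()) (λ ()) (λ ()) p₂₀ p₀₁ p₂₁
three-edges⇒splittable w (inj₂ p₁₀) (inj₁ p₁₂) (inj₁ p₀₂) =
  transitive⇒splittable w (λ ()) (λ ()) (λ ()) p₁₀ p₀₂ p₁₂
three-edges⇒splittable w (inj₂ p₁₀) (inj₁ p₁₂) (inj₂ p₂₀) =
  transitive⇒splittable w (λ ()) (λ ()) (λ ()) p₁₂ p₂₀ p₁₀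
three-edges⇒splittable w (inj₂ p₁₀) (inj₂ p₂₁) (inj₁ p₀₂) =
  cyclic⇒splittable w (λ ()) (λ ()) (λ ()) p₀₂ p₂₁ p₁₀
three-edges⇒splittable w (inj₂ p₁₀) (inj₂ p₂₁) (inj₂ p₂₀) =
  transitive⇒splittable w (λ ()) (λ ()) (λ ()) p₂₁ p₁₀ p₂₀

clique⇒splittable : ∀ (w : List (Fin (3 + k))) → IsClique r P (3 + k) w → Splittable P
clique⇒splittable w (_ , forms) = three-edges⇒splittable w
  (forms⇒oriented w (λ ()) (forms zero (suc zero) (λ ())))
  (forms⇒oriented w (λ ()) (forms (suc zero) (suc (suc zero)) (λ ())))
  (forms⇒oriented w (λ ()) (forms zero (suc (suc zero)) (λ ())))

ascending descending : (k t : ℕ) → List (Fin k)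
ascending  zero    t = []
ascending  (suc k) t = replicate t zero ++ map suc (ascending k t)
descending zero    t = []
descending (suc k) t = map suc (descending k t) ++ replicate t zero

blockWord : (k : ℕ) → ℕ × Bool → List (Fin k)
blockWord k (t , true)  = ascending k t
blockWord k (t , false) = descending k t

cliqueWord : (k : ℕ) → List (ℕ × Bool) → List (Fin k)
cliqueWord k = concatMap (blockWord k)

mark-ascending : ∀ k t ℓ (j : Fin k) → mapMaybe (mark ℓ j) (ascending k t) ≡ replicate t ℓ
mark-ascending (suc k) t ℓ zero =
  trans (mapMaybe-++ (mark ℓ zero) (replicate t zero) _)
    (trans (cong₂ _++_ (mapMaybe-replicate (mark ℓ zero) t zero)
                       (trans (mapMaybe-map (mark ℓ zero) suc (ascending k t))
                              (mapMaybe-nothing (ascending k t))))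
           (++-identityʳ (replicate t ℓ)))
mark-ascending (suc k) t ℓ (suc j) =
  trans (mapMaybe-++ (mark ℓ (suc j)) (replicate t zero) _)
    (cong₂ _++_ (mapMaybe-replicate (mark ℓ (suc j)) t zero)
                (trans (mapMaybe-map (mark ℓ (suc j)) suc (ascending k t)) (mark-ascending k t ℓ j)))

mark-descending : ∀ k t ℓ (j : Fin k) → mapMaybe (mark ℓ j) (descending k t) ≡ replicate t ℓ
mark-descending (suc k) t ℓ zero =
  trans (mapMaybe-++ (mark ℓ zero) (map suc (descending k t)) _)
    (cong₂ _++_ (trans (mapMaybe-map (mark ℓ zero) suc (descending k t))
                       (mapMaybe-nothing (descending k t)))
                (mapMaybe-replicate (mark ℓ zero) t zero))
mark-descending (suc k) t ℓ (suc j) =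
  trans (mapMaybe-++ (mark ℓ (suc j)) (map suc (descending k t)) _)
    (trans (cong₂ _++_ (trans (mapMaybe-map (mark ℓ (suc j)) suc (descending k t))
                              (mark-descending k t ℓ j))
                       (mapMaybe-replicate (mark ℓ (suc j)) t zero))
           (++-identityʳ (replicate t ℓ)))

project-ascending : ∀ k t {i j : Fin k} → i < j →
  project i j (ascending k t) ≡ replicate t A ++ replicate t B
project-ascending (suc k) t {zero} {suc j} _ =
  trans (mapMaybe-++ (label zero (suc j)) (replicate t zero) _)
    (cong₂ _++_ (mapMaybe-replicate (label zero (suc j)) t zero)
                (trans (mapMaybe-map (label zero (suc j)) suc (ascending k t)) (mark-ascending k t B j)))
project-ascending (suc k) t {suc i} {suc j} i<j =
  trans (mapMaybe-++ (label (suc i) (suc j)) (replicate t zero) _)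
    (cong₂ _++_ (mapMaybe-replicate (label (suc i) (suc j)) t zero)
                (trans (mapMaybe-map (label (suc i) (suc j)) suc (ascending k t))
                       (project-ascending k t (s≤s⁻¹ i<j))))

project-descending : ∀ k t {i j : Fin k} → i < j →
  project i j (descending k t) ≡ replicate t B ++ replicate t A
project-descending (suc k) t {zero} {suc j} _ =
  trans (mapMaybe-++ (label zero (suc j)) (map suc (descending k t)) _)
    (cong₂ _++_ (trans (mapMaybe-map (label zero (suc j)) suc (descending k t)) (mark-descending k t B j))
                (mapMaybe-replicate (label zero (suc j)) t zero))
project-descending (suc k) t {suc i} {suc j} i<j =
  trans (mapMaybe-++ (label (suc i) (suc j)) (map suc (descending k t)) _)
    (trans (cong₂ _++_ (trans (mapMaybe-map (label (suc i) (suc j)) suc (descending k t))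
                              (project-descending k t (s≤s⁻¹ i<j)))
                       (mapMaybe-replicate (label (suc i) (suc j)) t zero))
           (++-identityʳ _))

project-cliqueWord : ∀ k bs {i j : Fin k} → i < j → project i j (cliqueWord k bs) ≡ concatMap block bs
project-cliqueWord k []                  i<j = refl
project-cliqueWord k ((t , flag) ∷ bs) {i} {j} i<j =
  trans (mapMaybe-++ (label i j) (blockWord k (t , flag)) (cliqueWord k bs))
        (cong₂ _++_ (project-blockWord flag) (project-cliqueWord k bs i<j))
  where
  project-blockWord : ∀ flag → project i j (blockWord k (t , flag)) ≡ block (t , flag)
  project-blockWord true  = project-ascending k t i<j
  project-blockWord false = project-descending k t i<j

cliqueWord-forms : ∀ k bs {i j : Fin k} → ¬ i ≡ j →
  FormsPattern (cliqueWord k bs) i j (concatMap block bs)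
cliqueWord-forms k bs {i} {j} i≢j with <-cmp i j
... | tri< i<j _ _ = inj₁ (trans (restrict≡project (cliqueWord k bs) i j) (project-cliqueWord k bs i<j))
... | tri≈ _ i≡j _ = ⊥-elim (i≢j i≡j)
... | tri> _ _ j<i = inj₂ (begin
  map swapL (restrict (cliqueWord k bs) i j)  ≡⟨ cong (map swapL) (restrict≡project (cliqueWord k bs) i j) ⟩
  map swapL (project i j (cliqueWord k bs))   ≡⟨ project-swap (cliqueWord k bs) i≢j ⟨
  project j i (cliqueWord k bs)               ≡⟨ project-cliqueWord k bs j<i ⟩
  concatMap block bs                          ∎)

countA-project : ∀ (w : List (Fin k)) i j → countA (project i j w) ≡ length (filter (_≟ i) w)
countA-project []      i j = refl
countA-project (e ∷ w) i j with e ≟ i | e ≟ j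
... | yes _ | _     = cong suc (countA-project w i j)
... | no _  | yes _ = countA-project w i j
... | no _  | no _  = countA-project w i j

edge-size : ∀ (w : List (Fin k)) {i j} → IsPattern r P → FormsPattern w i j P →
  length (filter (_≟ i) w) ≡ r
edge-size w {i} {j} (_ , countA-P) (inj₁ eq) =
  trans (sym (countA-project w i j)) (trans (cong countA (trans (sym (restrict≡project w i j)) eq)) countA-P)
edge-size {r = r} {P = P} w {i} {j} (length-P , countA-P) (inj₂ eq) =
  trans (sym (countA-project w i j)) (trans (cong countA project≡swap-P) countA-swap-P)
  where
  project≡swap-P : project i j w ≡ map swapL P
  project≡swap-P = trans (sym (map-swapL-involutive _))
                          (cong (map swapL) (trans (cong (map swapL) (sym (restrict≡project w i j))) eq))
  countA-swap-P : countA (map swapL P) ≡ r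
  countA-swap-P = +-cancelʳ-≡ r _ _ (trans (cong (countA (map swapL P) +_) (sym countA-P))
                                           (trans (countA-swap P) length-P))

splittable⇒collectable : IsPattern r P → Splittable P → Collectable r P
splittable⇒collectable _ _ 1 (s≤s ())
splittable⇒collectable {r} isPattern (bs , refl) (suc (suc k)) _ =
  cliqueWord (2 + k) bs , matching , forms
  where
  forms : (i j : Fin (2 + k)) → ¬ i ≡ j → FormsPattern (cliqueWord (2 + k) bs) i j (concatMap block bs)
  forms i j i≢j = cliqueWord-forms (2 + k) bs i≢j
  other : Fin (2 + k) → Fin (2 + k)
  other zero    = suc zero
  other (suc _) = zero
  other≢ : ∀ i → ¬ i ≡ other i
  other≢ zero    ()
  other≢ (suc _) ()
  matching : IsMatching r (2 + k) (cliqueWord (2 + k) bs)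
  matching i = edge-size (cliqueWord (2 + k) bs) isPattern (forms i (other i) (other≢ i))

proposition2p1 : (r : ℕ) → 1 ≤ r → (P : List Letter) → IsPattern r P →
    (Collectable r P ⇔ Splittable P) ×
    (¬ Splittable P → (k : ℕ) (w : List (Fin k)) → IsClique r P k w → k ≤ 2)
proposition2p1 r _ P isPattern =
  mk⇔ collectable⇒splittable (splittable⇒collectable isPattern) , clique-bound
  where
  collectable⇒splittable : Collectable r P → Splittable P
  collectable⇒splittable collectable with w , clique ← collectable 3 (s≤s (s≤s z≤n)) =
    clique⇒splittable w clique
  clique-bound : ¬ Splittable P → (k : ℕ) (w : List (Fin k)) → IsClique r P k w → k ≤ 2
  clique-bound _            0                   _ _      = z≤n
  clique-bound _            1                   _ _      = s≤s z≤n
  clique-bound _            2                   _ _      = s≤s (s≤s z≤n)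
  clique-bound unsplittable (suc (suc (suc k))) w clique =
    ⊥-elim (unsplittable (clique⇒splittable w clique))
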